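{- Let $s$ be a step sequence over a g-comtrace alphabet $(E,sim,ser,inl)$. Then $G^{\{s\}}$ is a gso-structure.
   Context: Relations: for $R$ on $X$, $R^{ -1}$ inverse, $R^*=\bigcup_{i\ge0}R^i$ ($R^0=\mathrm{id}_X$), $R\circ S=\{(x,y):\exists z.\,xRz\wedge zSy\}$, $R^{\mathrm{sym}}=R\cup R^{ -1}$, $R^{\Cap}=R\cap R^{ -1}$, $R^C=(X\times X)\setminus R$. A g-comtrace alphabet is $(E,sim,ser,inl)$ with $E$ finite, $sim,inl\subseteq E\times E$ irreflexive and symmetric, $ser\subseteq sim$, $sim\cap inl=\emptyset$. Steps $\mathbb{S}$: nonempty $A\subseteq E$ with $(a,b)\in sim$ for all distinct $a,b\in A$; step sequences: elements of $\mathbb{S}^*$. $\equiv$ is the reflexive symmetric transitive closure of the pairs $(wAz,wBCz)$ ($A,B,C\in\mathbb{S}$, $A=B\cup C$, $B\times C\subseteq ser$) and $(wABz,wBAz)$ ($A,B\in\mathbb{S}$, $A\times B\subseteq inl$). For $s=A_1\dots A_k$: $\overline{A_i}=\{e^{(m+1)}:e\in A_i\}$ where $m$ is the number of $j<i$ with $e\in A_j$; $\Sigma_s=\bigcup_i\overline{A_i}$; $l(e^{(j)})=e$; $pos_s(\alpha)=i$ iff $\alpha\in\overline{A_i}$; $\alpha\lhd_s\beta$ iff $pos_s(\alpha)<pos_s(\beta)$; $\alpha\lhd_s^\frown\beta$ iff $\alpha\ne\beta\wedge pos_s(\alpha)\le pos_s(\beta)$. Closures: $(X,R_1,R_2)^\lozenge=(X,\prec_{R_1,R_2},\sqsubset_{R_1,R_2})$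 with $\prec_{R_1,R_2}=(R_1\cup R_2)^*\circ R_1\circ(R_1\cup R_2)^*$, $\sqsubset_{R_1,R_2}=(R_1\cup R_2)^*\setminus\mathrm{id}_X$; for $R_3=R_1\cap R_2^*$, $(X,R_1,R_2)^{\bowtie}=(X,(\prec_{R_3,R_2})^{\mathrm{sym}}\cup R_1,\sqsubset_{R_3,R_2})$. On $\Sigma_s$: $\alpha<\!\!>_s\beta$ iff $(l(\alpha),l(\beta))\in inl$; $\alpha\sqsubset_s\beta$ iff $\alpha\lhd_s^\frown\beta$ and $(l(\beta),l(\alpha))\notin ser\cup inl$; $\alpha\prec_s\beta$ iff $\alpha\lhd_s\beta$ and one of: (i) $(l(\alpha),l(\beta))\notin ser\cup inl$; (ii) $(\alpha,\beta)\in<\!\!>_s\cap((\sqsubset_s^*)^{\Cap}\circ(<\!\!>_s)^C\circ(\sqsubset_s^*)^{\Cap})$; (iii) $(l(\alpha),l(\beta))\in ser$ and there are $\delta,\gamma\in\Sigma_s$ with $\delta\lhd_s\gamma$, $(l(\delta),l(\gamma))\notin ser$, $\alpha\sqsubset_s^*\delta\sqsubset_s^*\beta$, $\alpha\sqsubset_s^*\gamma\sqsubset_s^*\beta$. $G^{\{s\}}=(\Sigma_s,\prec_s\cup<\!\!>_s,\prec_s\cup\sqsubset_s)^{\bowtie}$. An so-structure is $(X,\prec,\sqsubset)$ such that for all $a,b,c\in X$: $\neg(a\sqsubset a)$; $a\prec b\Rightarrow a\sqsubset b$; $a\sqsubset b\sqsubset c\wedge a\ne c\Rightarrow a\sqsubset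 c$; $(a\sqsubset b\prec c\vee a\prec b\sqsubset c)\Rightarrow a\prec c$. A gso-structure is $(X,<\!\!>,\sqsubset)$ with $\sqsubset$ irreflexive, $<\!\!>$ symmetric and irreflexive, and $(X,<\!\!>\cap\sqsubset,\sqsubset)$ an so-structure. -}

module Defs where

open import Level using (0ℓ)
open import Data.Nat using (ℕ; zero; suc; _≤_; _<_)
open import Data.Fin using (Fin)
open import Data.Fin.Subset using (Subset; _∈_; Nonempty)
open import Data.Fin.Subset.Properties using (_∈?_)
open import Data.List using (List; []; _∷_)
open import Data.Product using (Σ; ∃; _×_; _,_)
open import Data.Sum using (_⊎_)
open import Data.Empty using (⊥)
open import Relation.Nullary using (¬_; yes; no)
open import Relation.Binary.PropositionalEquality using (_≡_; _≢_)
open import Relation.Binary.Construct.Closure.ReflexiveTransitive using (Star)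

BRel : Set → Set₁
BRel X = X → X → Set

module _ {X : Set} where
  _⁻¹ʳ : BRel X → BRel X
  (R ⁻¹ʳ) x y = R y x

  _∪ʳ_ : BRel X → BRel X → BRel X
  (R ∪ʳ S) x y = R x y ⊎ S x y

  _∩ʳ_ : BRel X → BRel X → BRel X
  (R ∩ʳ S) x y = R x y × S x y

  _∘ʳ_ : BRel X → BRel X → BRel X
  (R ∘ʳ S) x y = ∃ λ z → R x z × S z y

  _ᶜ : BRel X → BRel X
  (R ᶜ) x y = ¬ R x y

  _* : BRel X → BRel X
  R * = Star R

  _ˢʸᵐ : BRel X → BRel X
  R ˢʸᵐ = R ∪ʳ (R ⁻¹ʳ)

  _⋒ : BRel X → BRel X
  R ⋒ = R ∩ʳ (R ⁻¹ʳ)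

  prec⟨_,_⟩ : BRel X → BRel X → BRel X
  prec⟨ R₁ , R₂ ⟩ = ((R₁ ∪ʳ R₂) *) ∘ʳ (R₁ ∘ʳ ((R₁ ∪ʳ R₂) *))

  sqsub⟨_,_⟩ : BRel X → BRel X → BRel X
  sqsub⟨ R₁ , R₂ ⟩ x y = ((R₁ ∪ʳ R₂) *) x y × x ≢ y

record RelTriple : Set₁ where
  constructor ⟪_,_,_⟫
  field
    carrier : Set
    rel₁    : BRel carrier
    rel₂    : BRel carrier

diamond : RelTriple → RelTriple
diamond ⟪ X , R₁ , R₂ ⟫ = ⟪ X , prec⟨ R₁ , R₂ ⟩ , sqsub⟨ R₁ , R₂ ⟩ ⟫

bowtie : RelTriple → RelTriple
bowtie ⟪ X , R₁ , R₂ ⟫ =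
  ⟪ X , ((prec⟨ R₃ , R₂ ⟩ ˢʸᵐ) ∪ʳ R₁) , sqsub⟨ R₃ , R₂ ⟩ ⟫
  where
  R₃ : BRel X
  R₃ = R₁ ∩ʳ (R₂ *)

record IsSoStructure (T : RelTriple) : Set where
  open RelTriple T renaming (carrier to X; rel₁ to _≺_; rel₂ to _⊏_)
  field
    irrefl   : ∀ a → ¬ (a ⊏ a)
    ≺⇒⊏      : ∀ {a b} → a ≺ b → a ⊏ b
    ⊏-trans  : ∀ {a b c} → a ⊏ b → b ⊏ c → a ≢ c → a ⊏ c
    mixed    : ∀ {a b c} → (a ⊏ b × b ≺ c) ⊎ (a ≺ b × b ⊏ c) → a ≺ c

record IsGsoStructure (T : RelTriple) : Set where
  open RelTriple T renaming (carrier to X; rel₁ to _<>_; rel₂ to _⊏_)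
  field
    ⊏-irrefl  : ∀ a → ¬ (a ⊏ a)
    <>-sym    : ∀ {a b} → a <> b → b <> a
    <>-irrefl : ∀ a → ¬ (a <> a)
    so        : IsSoStructure ⟪ X , (_<>_ ∩ʳ _⊏_) , _⊏_ ⟫

record GComtraceAlphabet (n : ℕ) : Set₁ where
  field
    sim ser inl : BRel (Fin n)
    sim-irrefl : ∀ a → ¬ sim a a
    sim-sym    : ∀ {a b} → sim a b → sim b a
    inl-irrefl : ∀ a → ¬ inl a a
    inl-sym    : ∀ {a b} → inl a b → inl b a
    ser⊆sim    : ∀ {a b} → ser a b → sim a b
    sim∩inl=∅  : ∀ {a b} → sim a b → inl a b → ⊥

module _ {n : ℕ} (Γ : GComtraceAlphabet n) where
  open GComtraceAlphabet Γ

  record Step : Set where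
    constructor mkStep
    field
      set      : Subset n
      nonempty : Nonempty set
      pairwise : ∀ {a b} → a ∈ set → b ∈ set → a ≢ b → sim a b

  StepSeq : Set
  StepSeq = List Step

  occ : StepSeq → Fin n → ℕ
  occ [] e = zero
  occ (A ∷ s) e with e ∈? Step.set A
  ... | yes _ = suc (occ s e)
  ... | no  _ = occ s e

  -- enumerated events e^(j), 1 ≤ j ≤ occ s e; this type is Σ_s
  record Ev (s : StepSeq) : Set where
    constructor _^⟨_⟩[_,_]
    field
      lbl   : Fin n
      idx   : ℕ
      idx≥1 : 1 ≤ idx
      idx≤  : idx ≤ occ s lbl

  -- position (1-based) of the (m+1)-th step of s containing e,
  -- i.e. pos_s(e^(m+1))
  posAux : StepSeq → Fin n → ℕ → ℕ
  posAux [] e m = zero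
  posAux (A ∷ s) e m with e ∈? Step.set A
  ... | no  _ = suc (posAux s e m)
  posAux (A ∷ s) e zero    | yes _ = 1
  posAux (A ∷ s) e (suc m) | yes _ = suc (posAux s e m)

  module _ (s : StepSeq) where
    l : Ev s → Fin n
    l = Ev.lbl

    pos : Ev s → ℕ
    pos α = posAux s (Ev.lbl α) (Data.Nat.pred (Ev.idx α))

    _◁_ : BRel (Ev s)
    α ◁ β = pos α < pos β

    _◁⌢_ : BRel (Ev s)
    α ◁⌢ β = α ≢ β × pos α ≤ pos β

    _<>_ : BRel (Ev s)
    α <> β = inl (l α) (l β)

    _⊏_ : BRel (Ev s)
    α ⊏ β = α ◁⌢ β × ¬ (ser (l β) (l α) ⊎ inl (l β) (l α))

    cond-ii : BRel (Ev s)
    cond-ii = _<>_ ∩ʳ ((((_⊏_ *) ⋒) ∘ʳ ((_<>_ ᶜ) ∘ʳ ((_⊏_ *) ⋒))))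

    cond-iii : BRel (Ev s)
    cond-iii α β = ser (l α) (l β) ×
      ∃ λ δ → ∃ λ γ → δ ◁ γ × ¬ ser (l δ) (l γ)
        × (_⊏_ *) α δ × (_⊏_ *) δ β × (_⊏_ *) α γ × (_⊏_ *) γ β

    _≺_ : BRel (Ev s)
    α ≺ β = α ◁ β × (¬ (ser (l α) (l β) ⊎ inl (l α) (l β)) ⊎ cond-ii α β ⊎ cond-iii α β)

    G : RelTriple
    G = bowtie ⟪ Ev s , (_≺_ ∪ʳ _<>_) , (_≺_ ∪ʳ _⊏_) ⟫

module Submission where

-- Put R₃ = R₁ ∩ R₂*, ⇝ = (R₃ ∪ R₂)* and ≺⋈ = prec⟨R₃,R₂⟩.  If ≺⋈ is
--   irreflexive, R₁ is irreflexive and R₁ is symmetric up to R₂*, then the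
--   ⋈-closure is a gso-structure.  The heart is that every pair related by the
--   closure's first relation and by ⇝ is already in ≺⋈, which absorbs ⇝ on
--   both sides; this yields the mixed transitivity laws.
-- * Acyclicity.  ≺⋈ is irreflexive as soon as some ℕ-valued measure is monotone
--   along R₂ and never constant along R₁: a cycle forces the measure to be
--   constant along its R₃-edge.
-- * Step sequences.  The position of an event is monotone along ≺_s ∪ ⊏_s, and
--   events at the same position lie in one step, so their labels are equal or
--   sim; hence ≺_s ∪ <>_s never relates events at equal positions.

open import Defs
open import Data.Nat using (ℕ; zero; suc; _≤_; _<_; s≤s)
open import Data.Nat.Properties using (≤-refl; ≤-trans; ≤-antisym; <⇒≢; <⇒≤)
open import Data.Fin using (Fin)
open import Data.Fin.Properties using (_≟_)
open import Data.Fin.Subset using (_∈_)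
open import Data.Fin.Subset.Properties using (_∈?_)
open import Data.List using (_∷_)
open import Data.Product using (_×_; _,_; proj₁; proj₂)
open import Data.Sum using (_⊎_; inj₁; inj₂)
open import Data.Empty using (⊥-elim)
open import Relation.Nullary using (¬_; yes; no)
open import Relation.Binary.PropositionalEquality using (_≡_; _≢_; refl; sym; subst)
open import Relation.Binary.Construct.Closure.ReflexiveTransitive using (ε; _◅_; _◅◅_)

module Closure {X : Set} (R₁ R₂ : BRel X) where

  R₃ : BRel X
  R₃ = R₁ ∩ʳ (R₂ *)

  _⇝_ : BRel X
  _⇝_ = (R₃ ∪ʳ R₂) *

  _≺⋈_ : BRel X
  _≺⋈_ = prec⟨ R₃ , R₂ ⟩

  _<>⋈_ _⊏⋈_ : BRel X
  _<>⋈_ = (_≺⋈_ ˢʸᵐ) ∪ʳ R₁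
  _⊏⋈_ = sqsub⟨ R₃ , R₂ ⟩

  -- R₃-steps are themselves R₂*-paths, so ⇝ is just R₂*.
  ⇝⇒R₂* : ∀ {x y} → x ⇝ y → (R₂ *) x y
  ⇝⇒R₂* ε                   = ε
  ⇝⇒R₂* (inj₁ (_ , p) ◅ ps) = p ◅◅ ⇝⇒R₂* ps
  ⇝⇒R₂* (inj₂ r ◅ ps)       = r ◅ ⇝⇒R₂* ps

  R₃⇒≺⋈ : ∀ {x y} → R₃ x y → x ≺⋈ y
  R₃⇒≺⋈ r = _ , ε , _ , r , ε

  ≺⋈⇒⇝ : ∀ {x y} → x ≺⋈ y → x ⇝ y
  ≺⋈⇒⇝ (_ , p , _ , r , q) = p ◅◅ (inj₁ r ◅ q)

  ⇝-≺⋈ : ∀ {x y z} → x ⇝ y → y ≺⋈ z → x ≺⋈ z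
  ⇝-≺⋈ p (u , p₁ , v , r , p₂) = u , p ◅◅ p₁ , v , r , p₂

  ≺⋈-⇝ : ∀ {x y z} → x ≺⋈ y → y ⇝ z → x ≺⋈ z
  ≺⋈-⇝ (u , p₁ , v , r , p₂) q = u , p₁ , v , r , p₂ ◅◅ q

  -- Acyclicity criterion: a measure monotone along R₂ and never constant along
  -- R₁ rules out cycles of ≺⋈ (along one, the measure would be constant).
  ≺⋈-irrefl-by-measure : (f : X → ℕ) →
    (∀ {x y} → R₂ x y → f x ≤ f y) → (∀ {x y} → R₁ x y → f x ≢ f y) →
    ∀ x → ¬ (x ≺⋈ x)
  ≺⋈-irrefl-by-measure f mono nonconst x (u , p , v , (r , q) , p′) =
    nonconst r (≤-antisym (mono* q) (mono* (⇝⇒R₂* (p′ ◅◅ p))))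
    where
    mono* : ∀ {x y} → (R₂ *) x y → f x ≤ f y
    mono* ε        = ≤-refl
    mono* (r ◅ rs) = ≤-trans (mono r) (mono* rs)

  module _ (≺⋈-irrefl : ∀ x → ¬ (x ≺⋈ x)) where

    -- A <>⋈-pair that is also ⇝-related is a ≺⋈-pair; the reversed ≺⋈
    -- alternative would close a cycle.
    <>⋈-⇝⇒≺⋈ : ∀ {x y} → x <>⋈ y → x ⇝ y → x ≺⋈ y
    <>⋈-⇝⇒≺⋈ (inj₁ (inj₁ p)) q = p
    <>⋈-⇝⇒≺⋈ (inj₁ (inj₂ p)) q = ⊥-elim (≺⋈-irrefl _ (≺⋈-⇝ p q))
    <>⋈-⇝⇒≺⋈ (inj₂ r)        q = R₃⇒≺⋈ (r , ⇝⇒R₂* q)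

    ≺⋈⇒<>⋈∩⊏⋈ : ∀ {x y} → x ≺⋈ y → (_<>⋈_ ∩ʳ _⊏⋈_) x y
    ≺⋈⇒<>⋈∩⊏⋈ p = inj₁ (inj₁ p) , ≺⋈⇒⇝ p , λ { refl → ≺⋈-irrefl _ p }

    bowtie-isGso : (∀ x → ¬ R₁ x x) → (∀ {x y} → R₁ x y → R₁ y x ⊎ (R₂ *) x y) →
      IsGsoStructure (bowtie ⟪ X , R₁ , R₂ ⟫)
    bowtie-isGso R₁-irrefl R₁-symUpTo = record
      { ⊏-irrefl  = λ _ h → proj₂ h refl
      ; <>-sym    = <>⋈-sym
      ; <>-irrefl = <>⋈-irrefl
      ; so        = record
        { irrefl  = λ _ h → proj₂ h refl
        ; ≺⇒⊏     = proj₂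
        ; ⊏-trans = λ p q x≢z → proj₁ p ◅◅ proj₁ q , x≢z
        ; mixed   = mixed
        }
      }
      where
      <>⋈-sym : ∀ {x y} → x <>⋈ y → y <>⋈ x
      <>⋈-sym (inj₁ (inj₁ p)) = inj₁ (inj₂ p)
      <>⋈-sym (inj₁ (inj₂ p)) = inj₁ (inj₁ p)
      <>⋈-sym (inj₂ r) with R₁-symUpTo r
      ... | inj₁ r′ = inj₂ r′
      ... | inj₂ q  = inj₁ (inj₂ (R₃⇒≺⋈ (r , q)))

      <>⋈-irrefl : ∀ x → ¬ (x <>⋈ x)
      <>⋈-irrefl x (inj₁ (inj₁ p)) = ≺⋈-irrefl x p
      <>⋈-irrefl x (inj₁ (inj₂ p)) = ≺⋈-irrefl x p
      <>⋈-irrefl x (inj₂ r)        = R₁-irrefl x r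

      mixed : ∀ {x y z} →
        (x ⊏⋈ y × (_<>⋈_ ∩ʳ _⊏⋈_) y z) ⊎ ((_<>⋈_ ∩ʳ _⊏⋈_) x y × y ⊏⋈ z) →
        (_<>⋈_ ∩ʳ _⊏⋈_) x z
      mixed (inj₁ ((p , _) , g , q , _)) = ≺⋈⇒<>⋈∩⊏⋈ (⇝-≺⋈ p (<>⋈-⇝⇒≺⋈ g q))
      mixed (inj₂ ((g , p , _) , q , _)) = ≺⋈⇒<>⋈∩⊏⋈ (≺⋈-⇝ (<>⋈-⇝⇒≺⋈ g p) q)

module Positions {n : ℕ} (Γ : GComtraceAlphabet n) where
  open GComtraceAlphabet Γ

  data InStep : StepSeq Γ → ℕ → Fin n → Set where
    here  : ∀ {A s e} → e ∈ Step.set A → InStep (A ∷ s) 1 e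
    there : ∀ {A s p e} → InStep s p e → InStep (A ∷ s) (suc p) e

  inStep-sim : ∀ {s p e f} → InStep s p e → InStep s p f → e ≡ f ⊎ sim e f
  inStep-sim {e = e} {f} (here {A} e∈A) (here f∈A) with e ≟ f
  ... | yes e≡f = inj₁ e≡f
  ... | no  e≢f = inj₂ (Step.pairwise A e∈A f∈A e≢f)
  inStep-sim (there e∈) (there f∈) = inStep-sim e∈ f∈
  inStep-sim (here _) (there ())
  inStep-sim (there ()) (here _)

  posAux-inStep : ∀ s e m → m < occ Γ s e → InStep s (posAux Γ s e m) e
  posAux-inStep (A ∷ s) e m m<occ with e ∈? Step.set A
  posAux-inStep (A ∷ s) e m       m<occ       | no _  = there (posAux-inStep s e m m<occ)
  posAux-inStep (A ∷ s) e zero    _           | yes p = here p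
  posAux-inStep (A ∷ s) e (suc m) (s≤s m<occ) | yes _ = there (posAux-inStep s e m m<occ)

  module _ (s : StepSeq Γ) where

    ev-inStep : (α : Ev Γ s) → InStep s (pos Γ s α) (l Γ s α)
    ev-inStep (e ^⟨ suc k ⟩[ _ , k<occ ]) = posAux-inStep s e k k<occ

    samePos-sim : ∀ {α β} → pos Γ s α ≡ pos Γ s β → l Γ s α ≡ l Γ s β ⊎ sim (l Γ s α) (l Γ s β)
    samePos-sim {α} {β} eq = inStep-sim (subst (λ p → InStep s p _) eq (ev-inStep α)) (ev-inStep β)

    ≺∪<>-pos≢ : ∀ {α β} → (_≺_ Γ s ∪ʳ _<>_ Γ s) α β → pos Γ s α ≢ pos Γ s β
    ≺∪<>-pos≢ (inj₁ (α◁β , _)) = <⇒≢ α◁β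
    ≺∪<>-pos≢ {α} {β} (inj₂ inl-αβ) eq with samePos-sim {α} {β} eq
    ... | inj₁ same = inl-irrefl _ (subst (inl (l Γ s α)) (sym same) inl-αβ)
    ... | inj₂ sim-αβ = sim∩inl=∅ sim-αβ inl-αβ

    ≺∪⊏-pos≤ : ∀ {α β} → (_≺_ Γ s ∪ʳ _⊏_ Γ s) α β → pos Γ s α ≤ pos Γ s β
    ≺∪⊏-pos≤ (inj₁ (α◁β , _))      = <⇒≤ α◁β
    ≺∪⊏-pos≤ (inj₂ ((_ , α≤β) , _)) = α≤β

theorem11p1 : ∀ {n : ℕ} (Γ : GComtraceAlphabet n) (s : StepSeq Γ) → IsGsoStructure (G Γ s)
theorem11p1 Γ s =
  bowtie-isGso acyclic R₁-irrefl R₁-symUpTo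
  where
  open GComtraceAlphabet Γ
  open Positions Γ
  open Closure (_≺_ Γ s ∪ʳ _<>_ Γ s) (_≺_ Γ s ∪ʳ _⊏_ Γ s)

  acyclic : ∀ α → ¬ (α ≺⋈ α)
  acyclic = ≺⋈-irrefl-by-measure (pos Γ s) (≺∪⊏-pos≤ s) (≺∪<>-pos≢ s)

  R₁-irrefl : ∀ α → ¬ (_≺_ Γ s ∪ʳ _<>_ Γ s) α α
  R₁-irrefl α r = ≺∪<>-pos≢ s r refl

  R₁-symUpTo : ∀ {α β} → (_≺_ Γ s ∪ʳ _<>_ Γ s) α β →
    (_≺_ Γ s ∪ʳ _<>_ Γ s) β α ⊎ ((_≺_ Γ s ∪ʳ _⊏_ Γ s) *) α β
  R₁-symUpTo (inj₁ α≺β)   = inj₂ (inj₁ α≺β ◅ ε)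
  R₁-symUpTo (inj₂ inl-αβ) = inj₁ (inj₂ (inl-sym inl-αβ))
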